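{- Let $m\ge 0$, $n\ge 1$ and $i\in\{0,1,\dots,m\}$. The set $\mathsf{W}^{(i)}(m,n)=\{\mathfrak{w}\in\mathsf{W}(m,n): \min(\mathfrak{w})\ge i\}$ is an interval of $\mathbf{W}(m,n)$, i.e. there exist $\mathfrak{u},\mathfrak{v}\in\mathsf{W}(m,n)$ with $\mathsf{W}^{(i)}(m,n)=\{\mathfrak{w}\in\mathsf{W}(m,n): \mathfrak{u}\le_{\mathsf{comp}}\mathfrak{w}\le_{\mathsf{comp}}\mathfrak{v}\}$.
   Context: An $(m,n)$-word is a word $\mathfrak{w}=w_1w_2\cdots w_n$ of length $n$ over the alphabet $\{0,1,\dots,m+1\}$ such that (MN1) $w_1\neq m+1$, and (MN2) for every $s$ with $1\le s\le m$ and every index $i$, if $w_i=s$ then $w_j\ge s$ for all $j<i$. $\mathsf{W}(m,n)$ is the set of $(m,n)$-words, and $\mathbf{W}(m,n)=(\mathsf{W}(m,n),\le_{\mathsf{comp}})$ with $\mathfrak{u}\le_{\mathsf{comp}}\mathfrak{v}$ iff $u_k\le v_k$ for all $k$. For a word $\mathfrak{w}$, $\min(\mathfrak{w})$ denotes its smallest letter. -}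

module Defs where

open import Data.Nat using (ℕ; zero; suc; _≤_; _<_)
open import Data.Fin using (Fin; toℕ)
open import Data.Product using (_×_)
open import Relation.Binary.PropositionalEquality using (_≡_; _≢_)

Word : ℕ → Set
Word n = Fin n → ℕ

-- w is an (m,n)-word:
--  * every letter lies in {0,1,…,m+1};
--  (MN1) the first letter (position 0, when n ≥ 1) is not m+1;
--  (MN2) for 1 ≤ s ≤ m, if w_i = s then w_j ≥ s for all j < i.
IsMNWord : (m n : ℕ) → Word n → Set
IsMNWord m n w =
  (∀ k → w k ≤ suc m)
  × (∀ k → toℕ k ≡ 0 → w k ≢ suc m)
  × (∀ (i j : Fin n) (s : ℕ) → 1 ≤ s → s ≤ m → w i ≡ s → toℕ j < toℕ i → s ≤ w j)

_≤comp_ : {n : ℕ} → Word n → Word n → Set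
u ≤comp v = ∀ k → u k ≤ v k

MinAtLeast : {n : ℕ} → ℕ → Word n → Set
MinAtLeast i w = ∀ k → i ≤ w k

-- The lower end is the constant word i i … i, since min(w) ≥ i says exactly that it lies below w.
-- The upper end is m (m+1) … (m+1), the largest (m,n)-word: every letter is at most m+1,
-- and by (MN1) the first one is at most m.
module Submission where

open import Defs
open import Data.Nat using (ℕ; suc; _≤_; _<_; s≤s)
open import Data.Nat.Properties using (≤∧≢⇒<; ≤-refl; n≤1+n; m≤n⇒m≤1+n; 1+n≰n)
open import Data.Fin using (Fin; toℕ) renaming (zero to fzero; suc to fsuc)
open import Data.Product using (Σ; _×_; _,_; proj₁)
open import Function.Base using (const)
open import Function.Bundles using (_⇔_; mk⇔)
open import Data.Empty using (⊥-elim)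
open import Relation.Binary.PropositionalEquality using (_≡_; _≢_; refl; subst)

const-isMNWord : ∀ {m n i} → i ≤ m → IsMNWord m n (const i)
const-isMNWord {m} {i = i} i≤m = letter-bound , first-not-top , prefix-bound
  where
  letter-bound : ∀ k → i ≤ suc m
  letter-bound _ = m≤n⇒m≤1+n i≤m

  first-not-top : ∀ k → toℕ k ≡ 0 → i ≢ suc m
  first-not-top _ _ i≡1+m = 1+n≰n (subst (_≤ m) i≡1+m i≤m)

  prefix-bound : ∀ k j s → 1 ≤ s → s ≤ m → i ≡ s → toℕ j < toℕ k → s ≤ i
  prefix-bound _ _ _ _ _ refl _ = ≤-refl

top : ∀ m {n} → Word n
top m fzero    = m
top m (fsuc _) = suc m

top-isMNWord : ∀ m n → IsMNWord m n (top m)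
top-isMNWord m n = letter-bound , first-not-top , prefix-bound
  where
  letter-bound : ∀ {n} (k : Fin n) → top m k ≤ suc m
  letter-bound fzero    = n≤1+n m
  letter-bound (fsuc _) = ≤-refl

  first-not-top : ∀ {n} (k : Fin n) → toℕ k ≡ 0 → top m k ≢ suc m
  first-not-top fzero _ ()
  first-not-top (fsuc _) ()

  -- a letter s ≤ m occurs only in the first position, which has no predecessors
  prefix-bound : ∀ {n} (k j : Fin n) s → 1 ≤ s → s ≤ m → top m k ≡ s → toℕ j < toℕ k → s ≤ top m j
  prefix-bound fzero j s _ _ _ ()
  prefix-bound (fsuc _) _ _ _ s≤m refl _ = ⊥-elim (1+n≰n s≤m)

≤comp-top : ∀ {m n} {w : Word n} → IsMNWord m n w → w ≤comp top m
≤comp-top (letter-bound , first-not-top , _) fzero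
  with ≤∧≢⇒< (letter-bound fzero) (first-not-top fzero refl)
... | s≤s w₀≤m = w₀≤m
≤comp-top (letter-bound , _ , _) (fsuc k) = letter-bound (fsuc k)

lemma4p1 : (m n i : ℕ) → 1 ≤ n → i ≤ m →
    Σ (Word n) λ u → Σ (Word n) λ v →
      IsMNWord m n u × IsMNWord m n v ×
      (∀ (w : Word n) → IsMNWord m n w →
        (MinAtLeast i w ⇔ (u ≤comp w × w ≤comp v)))
lemma4p1 m n i _ i≤m =
  const i , top m , const-isMNWord i≤m , top-isMNWord m n ,
  λ w w-isMNWord → mk⇔ (λ i≤w → i≤w , ≤comp-top w-isMNWord) proj₁
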